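{- Let $p\ge 1$, and let $X_p$ be the set of all $x\in\{0,1\}^{[p]\times[2]}$ whose first column is lexicographically not smaller than the second one. For $x\in X_p$ let $\mathrm{crit}(x)=\min(\{i\in[p]: x_{i,1}=1,x_{i,2}=0\}\cup\{p+1\})$ (so $x_{i,1}=x_{i,2}$ for all $i<\mathrm{crit}(x)$), and define $y(x)\in\{0,1\}^p$ by $y(x)=e_{\mathrm{crit}(x)}$ if $\mathrm{crit}(x)\le p$ and $y(x)=0$ otherwise; $\tilde x(x)\in\{0,1\}^{[p]\times[2]}$ by $(\tilde x(x)_{i,1},\tilde x(x)_{i,2})=(x_{i,1},x_{i,2})$ if $i>\mathrm{crit}(x)$ and $(0,0)$ otherwise; and $z(x)\in\{0,1\}^p$ by $z(x)_i=x_{i,1}(=x_{i,2})$ if $i<\mathrm{crit}(x)$ and $z(x)_i=0$ otherwise. Let $$Q_p^{\tilde x,y,z}=\operatorname{conv}\{(\tilde x(x),y(x),z(x)) : x\in X_p\}\subseteq \mathbb{R}^{[p]\times[2]}\times\mathbb{R}^p\times\mathbb{R}^p.$$ Then $Q_p^{\tilde x,y,z}$ is the set of all $(\tilde x,y,z)$ satisfying, for all $i\in[p]$ and $j\in[2]$: $$\tilde x_{i,1}-\sum_{k=1}^{i-1}y_k\le 0,\quad \tilde x_{i,2}-\sum_{k=1}^{i-1}y_k\le 0,\quad \sum_{k=1}^{i}y_k+z_i\le 1,\quad \tilde x_{i,j}\ge 0,\ y_i\ge 0,\ z_i\ge 0.$$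
   Context: $[p]=\{1,\dots,p\}$; $e_i$ denotes the $i$-th unit vector of $\mathbb{R}^p$.
   Formalization: Stated over ℚ: the points $(\tilde x,y,z)$ have rational coordinates and the weights of the convex combinations are rational rather than real. -}

module Defs where

open import Data.Bool using (Bool; true; false; _∧_; not; if_then_else_)
open import Data.Nat using (ℕ; zero; suc; _<ᵇ_; _≡ᵇ_)
open import Data.Fin using (Fin; zero; suc; toℕ)
open import Data.Rational using (ℚ; 0ℚ; 1ℚ; _+_; _*_; _≤_)
open import Data.Product using (Σ; _×_)
open import Data.Unit using (⊤)
open import Data.Sum using (_⊎_)
open import Relation.Binary.PropositionalEquality using (_≡_)

-- Indices are 0-based: row i ∈ Fin p stands for row (toℕ i + 1) of the paper;
-- column zero / suc zero of Fin 2 are the paper's columns 1 / 2.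

BMat : ℕ → Set
BMat p = Fin p → Fin 2 → Bool

LexGeq : (p : ℕ) → (Fin p → Bool) → (Fin p → Bool) → Set
LexGeq zero    a b = ⊤
LexGeq (suc p) a b =
  (a zero ≡ true × b zero ≡ false)
  ⊎ (a zero ≡ b zero × LexGeq p (λ i → a (suc i)) (λ i → b (suc i)))

InX : (p : ℕ) → BMat p → Set
InX p x = LexGeq p (λ i → x i zero) (λ i → x i (suc zero))

-- crit(x), 0-based: the least (0-based) row i with x_{i,1}=1, x_{i,2}=0,
-- or p if there is none (paper: p+1).
crit : (p : ℕ) → BMat p → ℕ
crit zero    x = zero
crit (suc p) x =
  if x zero zero ∧ not (x zero (suc zero)) then zero
  else suc (crit p (λ i → x (suc i)))

b2q : Bool → ℚ
b2q true  = 1ℚ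
b2q false = 0ℚ

xtOf : (p : ℕ) → BMat p → Fin p → Fin 2 → ℚ
xtOf p x i j = if crit p x <ᵇ toℕ i then b2q (x i j) else 0ℚ

yOf : (p : ℕ) → BMat p → Fin p → ℚ
yOf p x i = if toℕ i ≡ᵇ crit p x then 1ℚ else 0ℚ

zOf : (p : ℕ) → BMat p → Fin p → ℚ
zOf p x i = if toℕ i <ᵇ crit p x then b2q (x i zero) else 0ℚ

Σ[_] : (n : ℕ) → (Fin n → ℚ) → ℚ
Σ[ zero  ] f = 0ℚ
Σ[ suc n ] f = f zero + Σ[ n ] (λ k → f (suc k))

prefixSum : (p : ℕ) → (Fin p → ℚ) → ℕ → ℚ
prefixSum p y m = Σ[ p ] (λ k → if toℕ k <ᵇ m then y k else 0ℚ)

InConvHull : (p : ℕ) → (Fin p → Fin 2 → ℚ) → (Fin p → ℚ) → (Fin p → ℚ) → Set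
InConvHull p xt y z =
  Σ ℕ λ n → Σ (Fin n → BMat p) λ pts → Σ (Fin n → ℚ) λ w →
    ((k : Fin n) → InX p (pts k))
  × ((k : Fin n) → 0ℚ ≤ w k)
  × (Σ[ n ] w ≡ 1ℚ)
  × ((i : Fin p) (j : Fin 2) → xt i j ≡ Σ[ n ] (λ k → w k * xtOf p (pts k) i j))
  × ((i : Fin p) → y i ≡ Σ[ n ] (λ k → w k * yOf p (pts k) i))
  × ((i : Fin p) → z i ≡ Σ[ n ] (λ k → w k * zOf p (pts k) i))

Ineqs : (p : ℕ) → (Fin p → Fin 2 → ℚ) → (Fin p → ℚ) → (Fin p → ℚ) → Set
Ineqs p xt y z =
    ((i : Fin p) (j : Fin 2) → xt i j ≤ prefixSum p y (toℕ i))
  × ((i : Fin p) → prefixSum p y (suc (toℕ i)) + z i ≤ 1ℚ)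
  × ((i : Fin p) (j : Fin 2) → 0ℚ ≤ xt i j)
  × ((i : Fin p) → 0ℚ ≤ y i)
  × ((i : Fin p) → 0ℚ ≤ z i)

{-# OPTIONS --safe #-}
module Submission where

-- Necessity: every point (x̃(x), y(x), z(x)) satisfies the inequalities, whether or not x ∈ X_p,
-- and the inequalities are linear, so they pass to convex combinations.
-- Sufficiency: put Y_m = y_1 + … + y_m. For a threshold u ∈ [0, 1) let x(u) be the staircase
-- matrix whose critical row is the first r with u < Y_r (if any), whose rows above it are
-- ([1 - z_i ≤ u], [1 - z_i ≤ u]) and whose rows below it are ([u < x̃_{i,1}], [u < x̃_{i,2}]).
-- Then every coordinate of the point of x(u) is the indicator of an interval in u, namely
-- [0, x̃_{i,j}), [Y_{i-1}, Y_i) and [1 - z_i, 1), whose length is the corresponding coordinate of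
-- (x̃, y, z). So (x̃, y, z) is the integral over u ∈ [0, 1) of the point of x(u); the integrand is a
-- step function, so the integral is the left Riemann sum on the sorted list of all interval
-- endpoints, a convex combination of points of X_p.

open import Defs
open import Data.Bool using (Bool; true; false; _∧_; if_then_else_)
open import Data.Bool.Properties using (∧-zeroʳ)
open import Data.Empty using (⊥-elim)
open import Data.Fin using (Fin; zero; suc; toℕ)
open import Data.Fin.Properties using (toℕ<n)
open import Data.List using (List; []; _∷_; length; lookup; concat; tabulate)
open import Data.List.Membership.Propositional using (_∈_)
open import Data.List.Membership.Propositional.Properties using (∈-concat⁺′; ∈-tabulate⁺)
open import Data.List.Relation.Binary.Permutation.Propositional using (↭-sym)
open import Data.List.Relation.Binary.Permutation.Propositional.Properties using (∈-resp-↭; All-resp-↭)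
open import Data.List.Relation.Unary.All as All using (All; []; _∷_)
open import Data.List.Relation.Unary.All.Properties using (concat⁺; tabulate⁺)
open import Data.List.Relation.Unary.Any using (here; there)
open import Data.List.Relation.Unary.Linked using ([-]; _∷_)
open import Data.Nat using (ℕ; zero; suc; _≤_; _<_; _<ᵇ_; _≡ᵇ_; z≤n; s≤s)
import Data.Nat.Properties as ℕ
open import Data.Product using (_×_; _,_; proj₁; proj₂)
open import Data.Rational using (ℚ; 0ℚ; 1ℚ; _+_; _*_; _-_; -_; nonNegative)
import Data.Rational as ℚ
import Data.Rational.Properties as ℚ
open import Data.Rational.Solver using (module +-*-Solver)
open import Data.Sum using (inj₁; inj₂)
open import Data.Unit using (tt)
open import Function.Bundles using (_⇔_; mk⇔)
open import Relation.Binary.Bundles using (DecTotalOrder)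
open import Relation.Binary.Definitions using (tri<; tri≈; tri>)
open import Relation.Binary.PropositionalEquality
open import Relation.Nullary using (¬_; Dec)
open import Relation.Nullary.Decidable using (yes; no; does; dec-true; dec-false)
open import Relation.Nullary.Reflects using (ofʸ; ofⁿ)

open import Data.List.Relation.Unary.Sorted.TotalOrder (DecTotalOrder.totalOrder ℚ.≤-decTotalOrder) using (Sorted)
open import Data.List.Sort ℚ.≤-decTotalOrder using (sort; sort-↭; sort-↗)
open +-*-Solver

Σ-cong : ∀ n {f g : Fin n → ℚ} → (∀ k → f k ≡ g k) → Σ[ n ] f ≡ Σ[ n ] g
Σ-cong zero    f≗g = refl
Σ-cong (suc n) f≗g = cong₂ _+_ (f≗g zero) (Σ-cong n (λ k → f≗g (suc k)))

Σ-zero : ∀ n → Σ[ n ] (λ _ → 0ℚ) ≡ 0ℚ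
Σ-zero zero    = refl
Σ-zero (suc n) = trans (cong (0ℚ +_) (Σ-zero n)) (ℚ.+-identityˡ 0ℚ)

Σ-distrib-+ : ∀ n (f g : Fin n → ℚ) → Σ[ n ] (λ k → f k + g k) ≡ Σ[ n ] f + Σ[ n ] g
Σ-distrib-+ zero    f g = sym (ℚ.+-identityˡ 0ℚ)
Σ-distrib-+ (suc n) f g =
  trans (cong (f zero + g zero +_) (Σ-distrib-+ n (λ k → f (suc k)) (λ k → g (suc k))))
        (interchange (f zero) (g zero) _ _)
  where
  interchange : ∀ a b c d → (a + b) + (c + d) ≡ (a + c) + (b + d)
  interchange = solve 4 (λ a b c d → (a :+ b) :+ (c :+ d) := (a :+ c) :+ (b :+ d)) refl

*-distribˡ-Σ : ∀ n c (f : Fin n → ℚ) → Σ[ n ] (λ k → c * f k) ≡ c * Σ[ n ] f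
*-distribˡ-Σ zero    c f = sym (ℚ.*-zeroʳ c)
*-distribˡ-Σ (suc n) c f =
  trans (cong (c * f zero +_) (*-distribˡ-Σ n c (λ k → f (suc k)))) (sym (ℚ.*-distribˡ-+ c _ _))

Σ-comm : ∀ n m (f : Fin n → Fin m → ℚ) →
         Σ[ n ] (λ k → Σ[ m ] (f k)) ≡ Σ[ m ] (λ i → Σ[ n ] (λ k → f k i))
Σ-comm zero    m f = sym (Σ-zero m)
Σ-comm (suc n) m f =
  trans (cong (Σ[ m ] (f zero) +_) (Σ-comm n m (λ k → f (suc k)))) (sym (Σ-distrib-+ m (f zero) _))

Σ-mono-≤ : ∀ n {f g : Fin n → ℚ} → (∀ k → f k ℚ.≤ g k) → Σ[ n ] f ℚ.≤ Σ[ n ] g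
Σ-mono-≤ zero    f≤g = ℚ.≤-refl
Σ-mono-≤ (suc n) f≤g = ℚ.+-mono-≤ (f≤g zero) (Σ-mono-≤ n (λ k → f≤g (suc k)))

Σ-nonNeg : ∀ n {f : Fin n → ℚ} → (∀ k → 0ℚ ℚ.≤ f k) → 0ℚ ℚ.≤ Σ[ n ] f
Σ-nonNeg n 0≤f = subst (ℚ._≤ Σ[ n ] _) (Σ-zero n) (Σ-mono-≤ n 0≤f)

weighted : ∀ {n} → (Fin n → ℚ) → (Fin n → ℚ) → ℚ
weighted {n} w f = Σ[ n ] (λ k → w k * f k)

weighted-zeroʳ : ∀ {n} (w : Fin n → ℚ) → weighted w (λ _ → 0ℚ) ≡ 0ℚ
weighted-zeroʳ {n} w = trans (Σ-cong n (λ k → ℚ.*-zeroʳ (w k))) (Σ-zero n)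

weighted-identityʳ : ∀ {n} (w : Fin n → ℚ) → weighted w (λ _ → 1ℚ) ≡ Σ[ n ] w
weighted-identityʳ {n} w = Σ-cong n (λ k → ℚ.*-identityʳ (w k))

weighted-distrib-+ : ∀ {n} (w f g : Fin n → ℚ) →
                     weighted w (λ k → f k + g k) ≡ weighted w f + weighted w g
weighted-distrib-+ {n} w f g =
  trans (Σ-cong n (λ k → ℚ.*-distribˡ-+ (w k) (f k) (g k))) (Σ-distrib-+ n _ _)

module _ {n : ℕ} {w : Fin n → ℚ} (w≥0 : ∀ k → 0ℚ ℚ.≤ w k) where

  weighted-mono-≤ : {f g : Fin n → ℚ} → (∀ k → f k ℚ.≤ g k) → weighted w f ℚ.≤ weighted w g
  weighted-mono-≤ f≤g = Σ-mono-≤ n (λ k → ℚ.*-monoˡ-≤-nonNeg (w k) {{nonNegative (w≥0 k)}} (f≤g k))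

  weighted-nonNeg : {f : Fin n → ℚ} → (∀ k → 0ℚ ℚ.≤ f k) → 0ℚ ℚ.≤ weighted w f
  weighted-nonNeg 0≤f = subst (ℚ._≤ weighted w _) (weighted-zeroʳ w) (weighted-mono-≤ 0≤f)

if-nonNeg : ∀ b {a} → 0ℚ ℚ.≤ a → 0ℚ ℚ.≤ (if b then a else 0ℚ)
if-nonNeg true  0≤a = 0≤a
if-nonNeg false _   = ℚ.≤-refl

prefixSum-nonNeg : ∀ p {y : Fin p → ℚ} → (∀ i → 0ℚ ℚ.≤ y i) → ∀ m → 0ℚ ℚ.≤ prefixSum p y m
prefixSum-nonNeg p y≥0 m = Σ-nonNeg p (λ k → if-nonNeg (toℕ k <ᵇ m) (y≥0 k))

prefixSum-mono : ∀ p {y : Fin p → ℚ} → (∀ i → 0ℚ ℚ.≤ y i) →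
                 ∀ {m m′} → m ≤ m′ → prefixSum p y m ℚ.≤ prefixSum p y m′
prefixSum-mono p {y} y≥0 {m} {m′} m≤m′ = Σ-mono-≤ p (λ k → filter-mono (toℕ k))
  where
  filter-mono : ∀ {k : Fin p} r → (if r <ᵇ m then y k else 0ℚ) ℚ.≤ (if r <ᵇ m′ then y k else 0ℚ)
  filter-mono {k} r with r <ᵇ m | ℕ.<ᵇ-reflects-< r m | r <ᵇ m′ | ℕ.<ᵇ-reflects-< r m′
  ... | true  | _       | true  | _        = ℚ.≤-refl
  ... | true  | ofʸ r<m | false | ofⁿ r≮m′ = ⊥-elim (r≮m′ (ℕ.<-≤-trans r<m m≤m′))
  ... | false | _       | true  | _        = y≥0 k
  ... | false | _       | false | _        = ℚ.≤-refl

prefixSum-suc : ∀ p (y : Fin p → ℚ) i → prefixSum p y (suc (toℕ i)) ≡ prefixSum p y (toℕ i) + y i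
prefixSum-suc (suc p) y zero = begin
  y zero + Σ[ p ] (λ _ → 0ℚ)          ≡⟨ cong (y zero +_) (Σ-zero p) ⟩
  y zero + 0ℚ                          ≡⟨ ℚ.+-comm (y zero) 0ℚ ⟩
  0ℚ + y zero                          ≡⟨ cong (λ s → 0ℚ + s + y zero) (Σ-zero p) ⟨
  0ℚ + Σ[ p ] (λ _ → 0ℚ) + y zero     ∎
  where open ≡-Reasoning
prefixSum-suc (suc p) y (suc i) =
  trans (cong (y zero +_) (prefixSum-suc p (λ k → y (suc k)) i)) (sym (ℚ.+-assoc (y zero) _ _))

prefixSum-weighted : ∀ p {n} (w : Fin n → ℚ) (v : Fin n → Fin p → ℚ) m →
  prefixSum p (λ i → weighted w (λ k → v k i)) m ≡ weighted w (λ k → prefixSum p (v k) m)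
prefixSum-weighted p {n} w v m = begin
  Σ[ p ] (λ i → if toℕ i <ᵇ m then weighted w (λ k → v k i) else 0ℚ)
    ≡⟨ Σ-cong p (λ i → if-weighted (toℕ i <ᵇ m) (λ k → v k i)) ⟩
  Σ[ p ] (λ i → weighted w (λ k → if toℕ i <ᵇ m then v k i else 0ℚ))
    ≡⟨ Σ-comm n p (λ k i → w k * (if toℕ i <ᵇ m then v k i else 0ℚ)) ⟨
  Σ[ n ] (λ k → Σ[ p ] (λ i → w k * (if toℕ i <ᵇ m then v k i else 0ℚ)))
    ≡⟨ Σ-cong n (λ k → *-distribˡ-Σ p (w k) _) ⟩
  weighted w (λ k → prefixSum p (v k) m) ∎
  where
  open ≡-Reasoning
  if-weighted : ∀ b (f : Fin n → ℚ) →
                (if b then weighted w f else 0ℚ) ≡ weighted w (λ k → if b then f k else 0ℚ)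
  if-weighted true  f = refl
  if-weighted false f = sym (weighted-zeroʳ w)

-- e c is the c-th (0-based) unit vector, and the zero vector when c ≥ n; yOf p x is e (crit p x).
e : ∀ {n} → ℕ → Fin n → ℚ
e c i = if toℕ i ≡ᵇ c then 1ℚ else 0ℚ

prefixSum-e-≤ : ∀ n c m → m ≤ c → prefixSum n (e c) m ≡ 0ℚ
prefixSum-e-≤ zero    c       m       _         = refl
prefixSum-e-≤ (suc n) c       zero    _         = trans (cong (0ℚ +_) (Σ-zero n)) (ℚ.+-identityˡ 0ℚ)
prefixSum-e-≤ (suc n) (suc c) (suc m) (s≤s m≤c) =
  trans (cong (0ℚ +_) (prefixSum-e-≤ n c m m≤c)) (ℚ.+-identityˡ 0ℚ)

prefixSum-e-< : ∀ n c m → c < m → c < n → prefixSum n (e c) m ≡ 1ℚ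
prefixSum-e-< (suc n) zero    (suc m) _         _         =
  trans (cong (1ℚ +_) (trans (Σ-cong n (λ k → zero-either-way (toℕ k <ᵇ m))) (Σ-zero n)))
        (ℚ.+-identityʳ 1ℚ)
  where
  zero-either-way : ∀ b → (if b then 0ℚ else 0ℚ) ≡ 0ℚ
  zero-either-way true  = refl
  zero-either-way false = refl
prefixSum-e-< (suc n) (suc c) (suc m) (s≤s c<m) (s≤s c<n) =
  trans (cong (0ℚ +_) (prefixSum-e-< n c m c<m c<n)) (ℚ.+-identityˡ 1ℚ)

-- Necessity of the inequalities

b2q-nonNeg : ∀ b → 0ℚ ℚ.≤ b2q b
b2q-nonNeg true  = ℚ.<⇒≤ (ℚ.positive⁻¹ 1ℚ)
b2q-nonNeg false = ℚ.≤-refl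

b2q≤1 : ∀ b → b2q b ℚ.≤ 1ℚ
b2q≤1 true  = ℚ.≤-refl
b2q≤1 false = b2q-nonNeg true

e-nonNeg : ∀ {n} c (i : Fin n) → 0ℚ ℚ.≤ e c i
e-nonNeg c i = if-nonNeg (toℕ i ≡ᵇ c) (b2q-nonNeg true)

module _ (p : ℕ) (x : BMat p) where

  xtOf≤prefixSum-yOf : ∀ i j → xtOf p x i j ℚ.≤ prefixSum p (yOf p x) (toℕ i)
  xtOf≤prefixSum-yOf i j with crit p x <ᵇ toℕ i | ℕ.<ᵇ-reflects-< (crit p x) (toℕ i)
  ... | true  | ofʸ crit<i =
    subst (b2q (x i j) ℚ.≤_) (sym (prefixSum-e-< p (crit p x) (toℕ i) crit<i (ℕ.<-trans crit<i (toℕ<n i))))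
          (b2q≤1 (x i j))
  ... | false | ofⁿ _ = prefixSum-nonNeg p (e-nonNeg (crit p x)) (toℕ i)

  prefixSum-yOf+zOf≤1 : ∀ i → prefixSum p (yOf p x) (suc (toℕ i)) + zOf p x i ℚ.≤ 1ℚ
  prefixSum-yOf+zOf≤1 i with toℕ i <ᵇ crit p x | ℕ.<ᵇ-reflects-< (toℕ i) (crit p x)
  ... | true  | ofʸ i<crit =
    subst (λ s → s + b2q (x i zero) ℚ.≤ 1ℚ) (sym (prefixSum-e-≤ p (crit p x) (suc (toℕ i)) i<crit))
          (subst (ℚ._≤ 1ℚ) (sym (ℚ.+-identityˡ _)) (b2q≤1 (x i zero)))
  ... | false | ofⁿ i≮crit =
    subst (λ s → s + 0ℚ ℚ.≤ 1ℚ)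
          (sym (prefixSum-e-< p (crit p x) (suc (toℕ i)) (s≤s crit≤i) (ℕ.≤-<-trans crit≤i (toℕ<n i))))
          (ℚ.≤-reflexive (ℚ.+-identityʳ 1ℚ))
    where
    crit≤i : crit p x ≤ toℕ i
    crit≤i = ℕ.≮⇒≥ i≮crit

  xtOf-nonNeg : ∀ i j → 0ℚ ℚ.≤ xtOf p x i j
  xtOf-nonNeg i j = if-nonNeg (crit p x <ᵇ toℕ i) (b2q-nonNeg (x i j))

  zOf-nonNeg : ∀ i → 0ℚ ℚ.≤ zOf p x i
  zOf-nonNeg i = if-nonNeg (toℕ i <ᵇ crit p x) (b2q-nonNeg (x i zero))

convHull⇒ineqs : ∀ p xt y z → InConvHull p xt y z → Ineqs p xt y z
convHull⇒ineqs p xt y z (n , x , w , _ , w≥0 , Σw≡1 , xt≡ , y≡ , z≡) =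
    (λ i j → subst₂ ℚ._≤_ (sym (xt≡ i j)) (sym (prefixSum≡ (toℕ i)))
                          (weighted-mono-≤ w≥0 (λ k → xtOf≤prefixSum-yOf p (x k) i j)))
  , (λ i → subst₂ ℚ._≤_ (sym (trans (cong₂ _+_ (prefixSum≡ (suc (toℕ i))) (z≡ i))
                                     (sym (weighted-distrib-+ w _ _))))
                        (trans (weighted-identityʳ w) Σw≡1)
                        (weighted-mono-≤ w≥0 (λ k → prefixSum-yOf+zOf≤1 p (x k) i)))
  , (λ i j → subst (0ℚ ℚ.≤_) (sym (xt≡ i j)) (weighted-nonNeg w≥0 (λ k → xtOf-nonNeg p (x k) i j)))
  , (λ i → subst (0ℚ ℚ.≤_) (sym (y≡ i)) (weighted-nonNeg w≥0 (λ k → e-nonNeg (crit p (x k)) i)))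
  , (λ i → subst (0ℚ ℚ.≤_) (sym (z≡ i)) (weighted-nonNeg w≥0 (λ k → zOf-nonNeg p (x k) i)))
  where
  prefixSum≡ : ∀ m → prefixSum p y m ≡ weighted w (λ k → prefixSum p (yOf p (x k)) m)
  prefixSum≡ m = trans (Σ-cong p (λ i → cong (λ t → if toℕ i <ᵇ m then t else 0ℚ) (y≡ i)))
                       (prefixSum-weighted p w (λ k → yOf p (x k)) m)

isZero : Fin 2 → Bool
isZero zero    = true
isZero (suc _) = false

-- Every x ∈ X_p has this form with c = crit p x.
staircase : (p c : ℕ) → (Fin p → Bool) → BMat p → BMat p
staircase p c diag rest i j =
  if toℕ i <ᵇ c then diag i else if toℕ i ≡ᵇ c then isZero j else rest i j

crit-staircase : ∀ p c diag rest → c ≤ p → crit p (staircase p c diag rest) ≡ c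
crit-staircase zero    zero    diag rest _         = refl
crit-staircase (suc p) zero    diag rest _         = refl
crit-staircase (suc p) (suc c) diag rest (s≤s c≤p) with diag zero
... | true  = cong suc (crit-staircase p c (λ i → diag (suc i)) (λ i → rest (suc i)) c≤p)
... | false = cong suc (crit-staircase p c (λ i → diag (suc i)) (λ i → rest (suc i)) c≤p)

staircase∈X : ∀ p c diag rest → InX p (staircase p c diag rest)
staircase∈X zero    c       diag rest = tt
staircase∈X (suc p) zero    diag rest = inj₁ (refl , refl)
staircase∈X (suc p) (suc c) diag rest = inj₂ (refl , staircase∈X p c (λ i → diag (suc i)) (λ i → rest (suc i)))

staircase-below : ∀ p c diag rest (i : Fin p) j → c < toℕ i → staircase p c diag rest i j ≡ rest i j
staircase-below p c diag rest i j c<i with toℕ i <ᵇ c | ℕ.<ᵇ-reflects-< (toℕ i) c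
... | true  | ofʸ i<c = ⊥-elim (ℕ.<-asym i<c c<i)
... | false | _ rewrite dec-false (toℕ i ℕ.≟ c) (ℕ.>⇒≢ c<i) = refl

least : ℕ → (ℕ → Bool) → ℕ
least zero    P = zero
least (suc n) P = if P zero then zero else suc (least n (λ r → P (suc r)))

least≤ : ∀ n P → least n P ≤ n
least≤ zero    P = z≤n
least≤ (suc n) P with P zero
... | true  = z≤n
... | false = s≤s (least≤ n (λ r → P (suc r)))

<least⇒false : ∀ n P r → r < least n P → P r ≡ false
<least⇒false (suc n) P r       r<least with P zero in P0
<least⇒false (suc n) P zero    _         | false = P0
<least⇒false (suc n) P (suc r) (s≤s r<) | false = <least⇒false n (λ r → P (suc r)) r r<

least<⇒true : ∀ n P → least n P < n → P (least n P) ≡ true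
least<⇒true (suc n) P least<n with P zero in P0
... | true  = P0
... | false = least<⇒true n (λ r → P (suc r)) (ℕ.≤-pred least<n)

-- Riemann sums on a sorted partition

<⇒≱ : ∀ {a b} → a ℚ.< b → ¬ b ℚ.≤ a
<⇒≱ a<b b≤a = ℚ.<-irrefl refl (ℚ.<-≤-trans a<b b≤a)

≤⇒≯ : ∀ {a b} → a ℚ.≤ b → ¬ b ℚ.< a
≤⇒≯ a≤b b<a = <⇒≱ b<a a≤b

does-true : ∀ {A : Set} (a? : Dec A) → does a? ≡ true → A
does-true (yes a) _ = a

does-false : ∀ {A : Set} (a? : Dec A) → does a? ≡ false → ¬ A
does-false (no ¬a) _ = ¬a

_∈ᵇ⟨-∞,_⟩ : ℚ → ℚ → Bool
u ∈ᵇ⟨-∞, β ⟩ = does (u ℚ.<? β)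

_∈ᵇ[_,_⟩ : ℚ → ℚ → ℚ → Bool
u ∈ᵇ[ α , β ⟩ = does (α ℚ.≤? u) ∧ u ∈ᵇ⟨-∞, β ⟩

b2q-∈[,⟩-difference : ∀ {α β} → α ℚ.≤ β → ∀ u →
                       b2q (u ∈ᵇ[ α , β ⟩) ≡ b2q (u ∈ᵇ⟨-∞, β ⟩) - b2q (u ∈ᵇ⟨-∞, α ⟩)
b2q-∈[,⟩-difference {α} {β} α≤β u with u ℚ.<? α
... | yes u<α rewrite dec-true (u ℚ.<? α) u<α | dec-false (α ℚ.≤? u) (<⇒≱ u<α)
                    | dec-true (u ℚ.<? β) (ℚ.<-≤-trans u<α α≤β) = sym (ℚ.+-inverseʳ 1ℚ)
... | no u≮α  rewrite dec-false (u ℚ.<? α) u≮α | dec-true (α ℚ.≤? u) (ℚ.≮⇒≥ u≮α) =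
  sym (ℚ.+-identityʳ _)

-- Consecutive points a, b of a partition give the cell [a, b), recorded as (a , b - a).
cells : List ℚ → List (ℚ × ℚ)
cells (a ∷ b ∷ l) = (a , b - a) ∷ cells (b ∷ l)
cells _           = []

riemannSum : (ℚ → ℚ) → List ℚ → ℚ
riemannSum f (a ∷ b ∷ l) = (b - a) * f a + riemannSum f (b ∷ l)
riemannSum f _           = 0ℚ

Σ-cells : ∀ (f : ℚ → ℚ) S → let n = length (cells S); c = lookup (cells S) in
          Σ[ n ] (λ k → proj₂ (c k) * f (proj₁ (c k))) ≡ riemannSum f S
Σ-cells f []          = refl
Σ-cells f (a ∷ [])    = refl
Σ-cells f (a ∷ b ∷ l) = cong ((b - a) * f a +_) (Σ-cells f (b ∷ l))

cells-width-nonNeg : ∀ {S} → Sorted S → ∀ k → 0ℚ ℚ.≤ proj₂ (lookup (cells S) k)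
cells-width-nonNeg {a ∷ b ∷ l} (a≤b ∷ _) zero    =
  subst (ℚ._≤ b - a) (ℚ.+-inverseʳ a) (ℚ.+-monoˡ-≤ (- a) a≤b)
cells-width-nonNeg {a ∷ b ∷ l} (_   ∷ s) (suc k) = cells-width-nonNeg s k

cells-left-All : ∀ {P : ℚ → Set} {S} → All P S → ∀ k → P (proj₁ (lookup (cells S) k))
cells-left-All {S = a ∷ b ∷ l} (Pa ∷ _)  zero    = Pa
cells-left-All {S = a ∷ b ∷ l} (_  ∷ PS) (suc k) = cells-left-All PS k

last : ℚ → List ℚ → ℚ
last a []      = a
last a (b ∷ l) = last b l

last∈ : ∀ a l → last a l ∈ a ∷ l
last∈ a []      = here refl
last∈ a (b ∷ l) = there (last∈ b l)

head-≤ : ∀ {a l β} → Sorted (a ∷ l) → β ∈ a ∷ l → a ℚ.≤ β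
head-≤ _         (here refl) = ℚ.≤-refl
head-≤ (a≤b ∷ s) (there β∈)  = ℚ.≤-trans a≤b (head-≤ s β∈)

≤-last : ∀ {a l β} → Sorted (a ∷ l) → β ∈ a ∷ l → β ℚ.≤ last a l
≤-last [-]       (here refl) = ℚ.≤-refl
≤-last (a≤b ∷ s) (here refl) = ℚ.≤-trans a≤b (≤-last s (here refl))
≤-last (_   ∷ s) (there β∈)  = ≤-last s β∈

telescope : ∀ a b c → (b - a) * 1ℚ + (c - b) ≡ c - a
telescope = solve 3 (λ a b c → (b :- a) :* con 1ℚ :+ (c :- b) := c :- a) refl

riemannSum-one : ∀ a l → riemannSum (λ _ → 1ℚ) (a ∷ l) ≡ last a l - a
riemannSum-one a []      = sym (ℚ.+-inverseʳ a)
riemannSum-one a (b ∷ l) = trans (cong ((b - a) * 1ℚ +_) (riemannSum-one b l)) (telescope a b (last b l))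

riemannSum-below-≤head : ∀ {a l β} → Sorted (a ∷ l) → β ℚ.≤ a →
                         riemannSum (λ u → b2q (u ∈ᵇ⟨-∞, β ⟩)) (a ∷ l) ≡ 0ℚ
riemannSum-below-≤head                 [-]       β≤a = refl
riemannSum-below-≤head {a} {b ∷ l} {β} (a≤b ∷ s) β≤a rewrite dec-false (a ℚ.<? β) (≤⇒≯ β≤a) =
  trans (cong ((b - a) * 0ℚ +_) (riemannSum-below-≤head s (ℚ.≤-trans β≤a a≤b)))
        (trans (ℚ.+-identityʳ _) (ℚ.*-zeroʳ (b - a)))

riemannSum-below : ∀ {a l β} → Sorted (a ∷ l) → β ∈ a ∷ l →
                   riemannSum (λ u → b2q (u ∈ᵇ⟨-∞, β ⟩)) (a ∷ l) ≡ β - a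
riemannSum-below {a} s (here refl) = trans (riemannSum-below-≤head s ℚ.≤-refl) (sym (ℚ.+-inverseʳ a))
riemannSum-below {a} {b ∷ l} {β} (a≤b ∷ s) (there β∈) with a ℚ.<? β
... | yes a<β rewrite dec-true (a ℚ.<? β) a<β =
  trans (cong ((b - a) * 1ℚ +_) (riemannSum-below s β∈)) (telescope a b β)
... | no a≮β rewrite dec-false (a ℚ.<? β) a≮β = begin
  (b - a) * 0ℚ + riemannSum _ (b ∷ l)  ≡⟨ cong ((b - a) * 0ℚ +_) (riemannSum-below s β∈) ⟩
  (b - a) * 0ℚ + (β - b)                ≡⟨ cong (_+ (β - b)) (ℚ.*-zeroʳ (b - a)) ⟩
  0ℚ + (β - b)                          ≡⟨ ℚ.+-identityˡ (β - b) ⟩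
  β - b                                 ≡⟨ cong (λ t → β - t) b≡a ⟩
  β - a                                 ∎
  where
  open ≡-Reasoning
  -- β ≤ a ≤ b ≤ β, so the cell [a, b) is empty.
  b≡a : b ≡ a
  b≡a = ℚ.≤-antisym (ℚ.≤-trans (head-≤ s β∈) (ℚ.≮⇒≥ a≮β)) a≤b

riemannSum-difference : ∀ {f g h : ℚ → ℚ} → (∀ u → h u ≡ f u - g u) →
                        ∀ S → riemannSum h S ≡ riemannSum f S - riemannSum g S
riemannSum-difference h≡f-g []          = sym (ℚ.+-inverseʳ 0ℚ)
riemannSum-difference h≡f-g (a ∷ [])    = sym (ℚ.+-inverseʳ 0ℚ)
riemannSum-difference h≡f-g (a ∷ b ∷ l) =
  trans (cong₂ (λ s t → (b - a) * s + t) (h≡f-g a) (riemannSum-difference h≡f-g (b ∷ l)))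
        (regroup (b - a) _ _ _ _)
  where
  regroup : ∀ d x y r s → d * (x - y) + (r - s) ≡ (d * x + r) - (d * y + s)
  regroup = solve 5 (λ d x y r s → d :* (x :- y) :+ (r :- s) := (d :* x :+ r) :- (d :* y :+ s)) refl

riemannSum-interval : ∀ {S α β} → Sorted S → α ∈ S → β ∈ S → α ℚ.≤ β →
                      riemannSum (λ u → b2q (u ∈ᵇ[ α , β ⟩)) S ≡ β - α
riemannSum-interval {a ∷ l} {α} {β} s α∈ β∈ α≤β = begin
  riemannSum (λ u → b2q (u ∈ᵇ[ α , β ⟩)) (a ∷ l)
    ≡⟨ riemannSum-difference (b2q-∈[,⟩-difference α≤β) (a ∷ l) ⟩
  riemannSum (λ u → b2q (u ∈ᵇ⟨-∞, β ⟩)) (a ∷ l)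
    - riemannSum (λ u → b2q (u ∈ᵇ⟨-∞, α ⟩)) (a ∷ l)
    ≡⟨ cong₂ _-_ (riemannSum-below s β∈) (riemannSum-below s α∈) ⟩
  (β - a) - (α - a)
    ≡⟨ solve 3 (λ β α a → (β :- a) :- (α :- a) := β :- α) refl β α a ⟩
  β - α ∎
  where open ≡-Reasoning

In[0,1] : ℚ → Set
In[0,1] x = 0ℚ ℚ.≤ x × x ℚ.≤ 1ℚ

Σ-cells-width : ∀ {S} → Sorted S → All In[0,1] S → 0ℚ ∈ S → 1ℚ ∈ S →
                Σ[ length (cells S) ] (λ k → proj₂ (lookup (cells S) k)) ≡ 1ℚ
Σ-cells-width {a ∷ l} s S⊆[0,1] 0∈ 1∈ = begin
  Σ[ length (cells (a ∷ l)) ] (λ k → proj₂ (lookup (cells (a ∷ l)) k))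
    ≡⟨ Σ-cong (length (cells (a ∷ l))) (λ k → ℚ.*-identityʳ _) ⟨
  Σ[ length (cells (a ∷ l)) ] (λ k → proj₂ (lookup (cells (a ∷ l)) k) * 1ℚ)
    ≡⟨ Σ-cells (λ _ → 1ℚ) (a ∷ l) ⟩
  riemannSum (λ _ → 1ℚ) (a ∷ l)   ≡⟨ riemannSum-one a l ⟩
  last a l - a                      ≡⟨ cong₂ _-_ last≡1 a≡0 ⟩
  1ℚ - 0ℚ                           ≡⟨⟩
  1ℚ                                ∎
  where
  open ≡-Reasoning
  a≡0 : a ≡ 0ℚ
  a≡0 = ℚ.≤-antisym (head-≤ s 0∈) (proj₁ (All.head S⊆[0,1]))
  last≡1 : last a l ≡ 1ℚ
  last≡1 = ℚ.≤-antisym (proj₂ (All.lookup S⊆[0,1] (last∈ a l))) (≤-last s 1∈)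

-- Sufficiency: threshold vertices

module Threshold {p : ℕ} {xt : Fin p → Fin 2 → ℚ} {y z : Fin p → ℚ}
  (xt≤Y : ∀ i j → xt i j ℚ.≤ prefixSum p y (toℕ i))
  (Y+z≤1 : ∀ i → prefixSum p y (suc (toℕ i)) + z i ℚ.≤ 1ℚ)
  (xt≥0 : ∀ i j → 0ℚ ℚ.≤ xt i j)
  (y≥0 : ∀ i → 0ℚ ℚ.≤ y i)
  (z≥0 : ∀ i → 0ℚ ℚ.≤ z i) where

  Y : ℕ → ℚ
  Y = prefixSum p y

  Y-mono : ∀ {m m′} → m ≤ m′ → Y m ℚ.≤ Y m′
  Y-mono = prefixSum-mono p y≥0

  Y≤1-z : ∀ i → Y (suc (toℕ i)) ℚ.≤ 1ℚ - z i
  Y≤1-z i = subst (ℚ._≤ 1ℚ - z i) (cancelʳ (Y (suc (toℕ i))) (z i)) (ℚ.+-monoˡ-≤ (- z i) (Y+z≤1 i))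
    where
    cancelʳ : ∀ a b → (a + b) - b ≡ a
    cancelʳ = solve 2 (λ a b → (a :+ b) :- b := a) refl

  cut : ℚ → ℕ
  cut u = least p (λ r → u ∈ᵇ⟨-∞, Y (suc r) ⟩)

  upper : ℚ → Fin p → Bool
  upper u i = u ∈ᵇ[ 1ℚ - z i , 1ℚ ⟩

  lower : ℚ → BMat p
  lower u i j = u ∈ᵇ⟨-∞, xt i j ⟩

  vertex : ℚ → BMat p
  vertex u = staircase p (cut u) (upper u) (lower u)

  vertex∈X : ∀ u → InX p (vertex u)
  vertex∈X u = staircase∈X p (cut u) (upper u) (lower u)

  module _ {u : ℚ} (0≤u : 0ℚ ℚ.≤ u) where

    Y≤u : ∀ {m} → m ≤ cut u → Y m ℚ.≤ u
    Y≤u {zero}  _     = subst (ℚ._≤ u) (sym (Σ-zero p)) 0≤u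
    Y≤u {suc m} m<cut = ℚ.≮⇒≥ (does-false (u ℚ.<? Y (suc m)) (<least⇒false p _ m m<cut))

    u<Y : cut u < p → u ℚ.< Y (suc (cut u))
    u<Y cut<p = does-true (u ℚ.<? Y (suc (cut u))) (least<⇒true p _ cut<p)

    u<Y-after : ∀ {m} → cut u < m → m ≤ p → u ℚ.< Y m
    u<Y-after cut<m m≤p = ℚ.<-≤-trans (u<Y (ℕ.<-≤-trans cut<m m≤p)) (Y-mono cut<m)

    crit-vertex : crit p (vertex u) ≡ cut u
    crit-vertex = crit-staircase p (cut u) (upper u) (lower u) (least≤ p _)

    xtOf-vertex : ∀ i j → xtOf p (vertex u) i j ≡ b2q (u ∈ᵇ[ 0ℚ , xt i j ⟩)
    xtOf-vertex i j rewrite crit-vertex | dec-true (0ℚ ℚ.≤? u) 0≤u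
      with cut u <ᵇ toℕ i | ℕ.<ᵇ-reflects-< (cut u) (toℕ i)
    ... | true  | ofʸ cut<i = cong b2q (staircase-below p (cut u) (upper u) (lower u) i j cut<i)
    ... | false | ofⁿ cut≮i
      rewrite dec-false (u ℚ.<? xt i j) (≤⇒≯ (ℚ.≤-trans (xt≤Y i j) (Y≤u (ℕ.≮⇒≥ cut≮i)))) = refl

    yOf-vertex : ∀ i → yOf p (vertex u) i ≡ b2q (u ∈ᵇ[ Y (toℕ i) , Y (suc (toℕ i)) ⟩)
    yOf-vertex i rewrite crit-vertex with ℕ.<-cmp (toℕ i) (cut u)
    ... | tri< i<cut _ _ rewrite dec-false (toℕ i ℕ.≟ cut u) (ℕ.<⇒≢ i<cut)
                               | dec-false (u ℚ.<? Y (suc (toℕ i))) (≤⇒≯ (Y≤u i<cut))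
                               | ∧-zeroʳ (does (Y (toℕ i) ℚ.≤? u)) = refl
    ... | tri≈ _ i≡cut _ rewrite dec-true (toℕ i ℕ.≟ cut u) i≡cut
                               | dec-true (Y (toℕ i) ℚ.≤? u) (Y≤u (ℕ.≤-reflexive i≡cut))
                               | dec-true (u ℚ.<? Y (suc (toℕ i)))
                                          (subst (λ m → u ℚ.< Y (suc m)) (sym i≡cut)
                                                 (u<Y (subst (_< p) i≡cut (toℕ<n i)))) = refl
    ... | tri> _ _ cut<i rewrite dec-false (toℕ i ℕ.≟ cut u) (ℕ.>⇒≢ cut<i)
                               | dec-false (Y (toℕ i) ℚ.≤? u)
                                           (<⇒≱ (u<Y-after cut<i (ℕ.<⇒≤ (toℕ<n i)))) = refl

    zOf-vertex : ∀ i → zOf p (vertex u) i ≡ b2q (u ∈ᵇ[ 1ℚ - z i , 1ℚ ⟩)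
    zOf-vertex i rewrite crit-vertex with toℕ i <ᵇ cut u | ℕ.<ᵇ-reflects-< (toℕ i) (cut u)
    ... | true  | _ = refl
    ... | false | ofⁿ i≮cut
      rewrite dec-false (1ℚ - z i ℚ.≤? u)
                        (<⇒≱ (ℚ.<-≤-trans (u<Y-after (s≤s (ℕ.≮⇒≥ i≮cut)) (toℕ<n i))
                                          (Y≤1-z i))) = refl

  rowBreakpoints : Fin p → List ℚ
  rowBreakpoints i = xt i zero ∷ xt i (suc zero) ∷ Y (toℕ i) ∷ Y (suc (toℕ i)) ∷ 1ℚ - z i ∷ []

  candidates : List ℚ
  candidates = 0ℚ ∷ 1ℚ ∷ concat (tabulate rowBreakpoints)

  breakpoints : List ℚ
  breakpoints = sort candidates

  sorted : Sorted breakpoints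
  sorted = sort-↗ candidates

  ∈breakpoints : ∀ {x} → x ∈ candidates → x ∈ breakpoints
  ∈breakpoints = ∈-resp-↭ (↭-sym (sort-↭ candidates))

  ∈row⇒∈breakpoints : ∀ i {x} → x ∈ rowBreakpoints i → x ∈ breakpoints
  ∈row⇒∈breakpoints i x∈ = ∈breakpoints (there (there (∈-concat⁺′ x∈ (∈-tabulate⁺ i))))

  1-z≤1 : ∀ i → 1ℚ - z i ℚ.≤ 1ℚ
  1-z≤1 i = subst (1ℚ - z i ℚ.≤_) (ℚ.+-identityʳ 1ℚ) (ℚ.+-monoʳ-≤ 1ℚ (ℚ.neg-antimono-≤ (z≥0 i)))

  breakpoints∈[0,1] : All In[0,1] breakpoints
  breakpoints∈[0,1] = All-resp-↭ (↭-sym (sort-↭ candidates))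
    ((ℚ.≤-refl , b2q-nonNeg true) ∷ (b2q-nonNeg true , ℚ.≤-refl) ∷ concat⁺ (tabulate⁺ row∈[0,1]))
    where
    Y≥0 : ∀ m → 0ℚ ℚ.≤ Y m
    Y≥0 = prefixSum-nonNeg p y≥0
    Y[i+1]≤1 : ∀ i → Y (suc (toℕ i)) ℚ.≤ 1ℚ
    Y[i+1]≤1 i = ℚ.≤-trans (Y≤1-z i) (1-z≤1 i)
    Y[i]≤1 : ∀ i → Y (toℕ i) ℚ.≤ 1ℚ
    Y[i]≤1 i = ℚ.≤-trans (Y-mono (ℕ.n≤1+n _)) (Y[i+1]≤1 i)
    row∈[0,1] : ∀ i → All In[0,1] (rowBreakpoints i)
    row∈[0,1] i = (xt≥0 i zero , ℚ.≤-trans (xt≤Y i zero) (Y[i]≤1 i))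
                ∷ (xt≥0 i (suc zero) , ℚ.≤-trans (xt≤Y i (suc zero)) (Y[i]≤1 i))
                ∷ (Y≥0 (toℕ i) , Y[i]≤1 i)
                ∷ (Y≥0 (suc (toℕ i)) , Y[i+1]≤1 i)
                ∷ (ℚ.≤-trans (Y≥0 (suc (toℕ i))) (Y≤1-z i) , 1-z≤1 i)
                ∷ []

  n : ℕ
  n = length (cells breakpoints)

  point width : Fin n → ℚ
  point k = proj₁ (lookup (cells breakpoints) k)
  width k = proj₂ (lookup (cells breakpoints) k)

  weighted-vertex : ∀ (f : BMat p → ℚ) {α β} →
                    (∀ {u} → 0ℚ ℚ.≤ u → f (vertex u) ≡ b2q (u ∈ᵇ[ α , β ⟩)) →
                    α ∈ breakpoints → β ∈ breakpoints → α ℚ.≤ β →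
                    weighted width (λ k → f (vertex (point k))) ≡ β - α
  weighted-vertex f f≡𝟙 α∈ β∈ α≤β =
    trans (Σ-cong n (λ k → cong (width k *_) (f≡𝟙 (proj₁ (cells-left-All breakpoints∈[0,1] k)))))
          (trans (Σ-cells _ breakpoints) (riemannSum-interval sorted α∈ β∈ α≤β))

  xt≡weighted : ∀ i j → xt i j ≡ weighted width (λ k → xtOf p (vertex (point k)) i j)
  xt≡weighted i j = sym (trans (weighted-vertex (λ x → xtOf p x i j) (λ 0≤u → xtOf-vertex 0≤u i j)
                                                (∈breakpoints (here refl)) (∈row⇒∈breakpoints i (xt∈row j))
                                                (xt≥0 i j))
                               (ℚ.+-identityʳ (xt i j)))
    where
    xt∈row : ∀ j → xt i j ∈ rowBreakpoints i
    xt∈row zero       = here refl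
    xt∈row (suc zero) = there (here refl)

  y≡weighted : ∀ i → y i ≡ weighted width (λ k → yOf p (vertex (point k)) i)
  y≡weighted i = sym (begin
    weighted width (λ k → yOf p (vertex (point k)) i)
      ≡⟨ weighted-vertex (λ x → yOf p x i) (λ 0≤u → yOf-vertex 0≤u i)
                         (∈row⇒∈breakpoints i (there (there (here refl))))
                         (∈row⇒∈breakpoints i (there (there (there (here refl)))))
                         (Y-mono (ℕ.n≤1+n _)) ⟩
    Y (suc (toℕ i)) - Y (toℕ i)      ≡⟨ cong (_- Y (toℕ i)) (prefixSum-suc p y i) ⟩
    (Y (toℕ i) + y i) - Y (toℕ i)    ≡⟨ solve 2 (λ a b → (a :+ b) :- a := b) refl (Y (toℕ i)) (y i) ⟩
    y i                              ∎)
    where open ≡-Reasoning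

  z≡weighted : ∀ i → z i ≡ weighted width (λ k → zOf p (vertex (point k)) i)
  z≡weighted i = sym (trans (weighted-vertex (λ x → zOf p x i) (λ 0≤u → zOf-vertex 0≤u i)
                                             (∈row⇒∈breakpoints i (there (there (there (there (here refl))))))
                                             (∈breakpoints (there (here refl))) (1-z≤1 i))
                            (solve 1 (λ a → con 1ℚ :- (con 1ℚ :- a) := a) refl (z i)))

  inConvHull : InConvHull p xt y z
  inConvHull = n , (λ k → vertex (point k)) , width , (λ k → vertex∈X (point k))
             , cells-width-nonNeg sorted
             , Σ-cells-width sorted breakpoints∈[0,1] (∈breakpoints (here refl)) (∈breakpoints (there (here refl)))
             , xt≡weighted , y≡weighted , z≡weighted

ineqs⇒convHull : ∀ p xt y z → Ineqs p xt y z → InConvHull p xt y z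
ineqs⇒convHull p xt y z (xt≤Y , Y+z≤1 , xt≥0 , y≥0 , z≥0) =
  Threshold.inConvHull xt≤Y Y+z≤1 xt≥0 y≥0 z≥0

mainTheorem3 : (p : ℕ) → 1 ≤ p →
    (xt : Fin p → Fin 2 → ℚ) (y : Fin p → ℚ) (z : Fin p → ℚ) →
    InConvHull p xt y z ⇔ Ineqs p xt y z
mainTheorem3 p _ xt y z = mk⇔ (convHull⇒ineqs p xt y z) (ineqs⇒convHull p xt y z)
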